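{- Let $G$ be a graph without isolated vertices, let $Y$ be a uniform NFBDD realizing $\phi(G)$, let $a$ be a non-leaf node of $Y$ with $Var(a)=x_v$, let $a'$ be an out-neighbour of $a$, and let $B$ be a distant independent set of $G$. (1) If $v\in B$ then $rw_{a'}(B\setminus\{v\})=rw_a(B)/(1-2^{ -(ld_a(v)+1)})$. (2) If there is $w\in B$ with $\{v,w\}\in E(G)$, then $rw_{a'}(B\setminus\{w\})=rw_a(B)/(1-2^{ -(ld_a(w)+1)})$ and $rw_{a'}(B)=rw_a(B)\cdot\frac{1-2^{ -ld_a(w)}}{1-2^{ -(ld_a(w)+1)}}$. (3) If neither assumption holds, then $rw_{a'}(B)=rw_a(B)$.
   Context: $\phi(G)$ is the monotone 2-CNF with variables $\{x_v: v\in V(G)\}$ and clauses $(x_u\vee x_v)$ for $\{u,v\}\in E(G)$. An NROBP realizing $F$ is a connected DAG (multiple edges allowed) with one root and one leaf, some edges labelled by literals, no directed path containing two edges labelled by literals of the same variable; with $A(P)$ the literals on $P$, every extension of $A(P)$ for a root-to-leaf $P$ satisfies $F$ and every satisfying assignment contains some such $A(P)$. Uniform: paths from the root to the same node carry literals of the same variable set, and root-to-leaf paths carry literals of all variables. An NFBDD is an NROBP in which every edge is labelled, every node has out-degree at most $2$, and the two out-edges of a node of out-degree $2$ are labelled by opposite literals of the same variable; $Var(a)$ is the variable labelling the out-edges of $a$. A distant independent set is an independent set in which no two vertices have a common neighbour. $\mathrm{Vert}_a$ is the set of $u\in V(G)$ such that $x_u$ does not occur on paths from the root to $a$; $ld_a(u)$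 is the number of neighbours of $u$ in $\mathrm{Vert}_a$; $rw_a(B)=\prod_{u\in B}(1-2^{ -(ld_a(u)+1)})$ (equal to $1$ for $B=\emptyset$). -}

module Defs where

open import Data.Nat as ℕ using (ℕ; zero; suc; _≤_)
open import Data.Bool using (Bool; true; false; not; _∨_)
open import Data.Fin using (Fin; _≟_)
open import Data.Fin.Subset using (Subset; _∈_; _∉_; _∩_; ∣_∣)
open import Data.Vec using (Vec; []; _∷_; tabulate)
open import Data.List using (List; []; _∷_; map; filter; length; allFin)
open import Data.List.Relation.Unary.All using (All)
open import Data.List.Relation.Unary.Unique.Propositional using (Unique)
import Data.List.Membership.Propositional as L
open import Data.Product using (Σ; ∃; _×_; _,_; proj₁; proj₂)
open import Data.Empty using (⊥)
open import Relation.Nullary using (¬_)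
open import Relation.Binary.PropositionalEquality using (_≡_; _≢_; refl; sym; trans; cong)
open import Function.Bundles using (_⇔_)
open import Data.Rational as ℚ using (ℚ; 0ℚ; 1ℚ; ½; _*_; _-_; _+_; _<_; NonZero)
import Data.Rational.Properties as ℚP
open import Relation.Nullary.Decidable using (toWitness)

record Graph (n : ℕ) : Set where
  field
    adj    : Fin n → Fin n → Bool
    adj-sym    : ∀ u w → adj u w ≡ adj w u
    adj-irrefl : ∀ u → adj u u ≡ false
open Graph public

NoIsolated : ∀ {n} → Graph n → Set
NoIsolated {n} G = ∀ (u : Fin n) → ∃ λ w → adj G u w ≡ true

N : ∀ {n} → Graph n → Fin n → Subset n
N G u = tabulate (adj G u)

DistantIndep : ∀ {n} → Graph n → Subset n → Set
DistantIndep {n} G B =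
  (∀ u w → u ∈ B → w ∈ B → adj G u w ≡ false) ×
  (∀ u w z → u ∈ B → w ∈ B → u ≢ w → adj G u z ≡ true → adj G w z ≡ false)

Lit : ℕ → Set
Lit n = Fin n × Bool   -- (u , true) = x_u ,  (u , false) = ¬ x_u

var : ∀ {n} → Lit n → Fin n
var = proj₁

pol : ∀ {n} → Lit n → Bool
pol = proj₂

Assignment : ℕ → Set
Assignment n = Fin n → Bool

TrueUnder : ∀ {n} → Assignment n → Lit n → Set
TrueUnder σ l = σ (var l) ≡ pol l

Satφ : ∀ {n} → Graph n → Assignment n → Set
Satφ G σ = ∀ u w → adj G u w ≡ true → (σ u ∨ σ w) ≡ true

-- Branching programs with all edges labelled by literals
-- (multi-edges allowed: edges are indexed by Fin edges).

record LBP (n : ℕ) : Set where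
  field
    nodes edges : ℕ
    src tgt : Fin edges → Fin nodes
    lab     : Fin edges → Lit n
    root leaf : Fin nodes
open LBP public

Node : ∀ {n} → LBP n → Set
Node Y = Fin (nodes Y)

Edge : ∀ {n} → LBP n → Set
Edge Y = Fin (edges Y)

data Path {n} (Y : LBP n) : Node Y → Node Y → Set where
  [] : ∀ {p} → Path Y p p
  _∷⟨_⟩_ : ∀ {p q} (e : Edge Y) → src Y e ≡ p → Path Y (tgt Y e) q → Path Y p q

lits : ∀ {n} {Y : LBP n} {p q} → Path Y p q → List (Lit n)
lits [] = []
lits {Y = Y} (e ∷⟨ _ ⟩ P) = lab Y e ∷ lits P

vars : ∀ {n} {Y : LBP n} {p q} → Path Y p q → List (Fin n)
vars P = map var (lits P)

data UPath {n} (Y : LBP n) : Node Y → Node Y → Set where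
  [] : ∀ {p} → UPath Y p p
  fwd : ∀ {p q} (e : Edge Y) → src Y e ≡ p → UPath Y (tgt Y e) q → UPath Y p q
  bwd : ∀ {p q} (e : Edge Y) → tgt Y e ≡ p → UPath Y (src Y e) q → UPath Y p q

outdeg : ∀ {n} (Y : LBP n) → Node Y → ℕ
outdeg Y a = length (filter (λ e → src Y e ≟ a) (allFin (edges Y)))

record IsNROBP {n} (Y : LBP n) : Set where
  field
    acyclic   : ∀ (e : Edge Y) → Path Y (tgt Y e) (src Y e) → ⊥
    connected : ∀ (p q : Node Y) → UPath Y p q
    one-root  : ∀ (p : Node Y) → (p ≡ root Y) ⇔ (∀ (e : Edge Y) → tgt Y e ≢ p)
    one-leaf  : ∀ (p : Node Y) → (p ≡ leaf Y) ⇔ (∀ (e : Edge Y) → src Y e ≢ p)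
    read-once : ∀ {p q : Node Y} (P : Path Y p q) → Unique (vars P)

record IsNFBDD {n} (Y : LBP n) : Set where
  field
    nrobp    : IsNROBP Y
    outdeg≤2 : ∀ (a : Node Y) → outdeg Y a ≤ 2
    opposite : ∀ (e₁ e₂ : Edge Y) → e₁ ≢ e₂ → src Y e₁ ≡ src Y e₂ →
               (var (lab Y e₁) ≡ var (lab Y e₂)) × (pol (lab Y e₂) ≡ not (pol (lab Y e₁)))

Realizes : ∀ {n} (Y : LBP n) → (Assignment n → Set) → Set
Realizes {n} Y F =
  (∀ (P : Path Y (root Y) (leaf Y)) (σ : Assignment n) → All (TrueUnder σ) (lits P) → F σ) ×
  (∀ (σ : Assignment n) → F σ → Σ (Path Y (root Y) (leaf Y)) λ P → All (TrueUnder σ) (lits P))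

Uniform : ∀ {n} (Y : LBP n) → Set
Uniform {n} Y =
  (∀ (p : Node Y) (P Q : Path Y (root Y) p) (u : Fin n) → u L.∈ vars P → u L.∈ vars Q) ×
  (∀ (P : Path Y (root Y) (leaf Y)) (u : Fin n) → u L.∈ vars P)

VarIs : ∀ {n} (Y : LBP n) → Node Y → Fin n → Set
VarIs Y a v = (∃ λ (e : Edge Y) → src Y e ≡ a) × (∀ (e : Edge Y) → src Y e ≡ a → var (lab Y e) ≡ v)

OutNeighbour : ∀ {n} (Y : LBP n) → Node Y → Node Y → Set
OutNeighbour Y a a' = ∃ λ (e : Edge Y) → src Y e ≡ a × tgt Y e ≡ a'

IsVert : ∀ {n} (Y : LBP n) → Node Y → Subset n → Set
IsVert {n} Y a S = ∀ (u : Fin n) → (u ∈ S) ⇔ (∀ (P : Path Y (root Y) a) → ¬ (u L.∈ vars P))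

halfPow : ℕ → ℚ
halfPow zero = 1ℚ
halfPow (suc k) = ½ * halfPow k

factor : ℕ → ℚ
factor k = 1ℚ - halfPow (suc k)

private
  halfPow≤1 : ∀ k → halfPow k ℚ.≤ 1ℚ
  halfPow≤1 zero = ℚP.≤-refl
  halfPow≤1 (suc k) = ℚP.≤-trans (ℚP.*-monoˡ-≤-nonNeg ½ (halfPow≤1 k))
                        (ℚP.≤-trans (ℚP.≤-reflexive (ℚP.*-identityʳ ½)) (ℚP.<⇒≤ ½<1))
    where
    ½<1 : ½ < 1ℚ
    ½<1 = toWitness {a? = ½ ℚP.<? 1ℚ} _

  halfPowS<1 : ∀ k → halfPow (suc k) < 1ℚ
  halfPowS<1 k = ℚP.≤-<-trans (ℚP.*-monoˡ-≤-nonNeg ½ (halfPow≤1 k))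
                   (ℚP.≤-<-trans (ℚP.≤-reflexive (ℚP.*-identityʳ ½)) (toWitness {a? = ½ ℚP.<? 1ℚ} _))

  factor-pos : ∀ k → factor k ℚ.> 0ℚ
  factor-pos k = ℚP.<-respˡ-≡ (ℚP.+-inverseʳ (halfPow (suc k)))
                   (ℚP.+-monoˡ-< (ℚ.- halfPow (suc k)) (halfPowS<1 k))

instance
  factor-nonZero : ∀ {k} → NonZero (factor k)
  factor-nonZero {k} = ℚ.>-nonZero (factor-pos k)

prodOver : ∀ {n} → Subset n → (Fin n → ℚ) → ℚ
prodOver [] f = 1ℚ
prodOver (true ∷ B) f = f Fin.zero * prodOver B (λ i → f (Fin.suc i))
  where import Data.Fin as Fin
prodOver (false ∷ B) f = prodOver B (λ i → f (Fin.suc i))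
  where import Data.Fin as Fin

-- ld_a(u) where Va = Vert_a
ld : ∀ {n} → Graph n → Subset n → Fin n → ℕ
ld G Va u = ∣ N G u ∩ Va ∣

rw : ∀ {n} → Graph n → Subset n → Subset n → ℚ
rw G Va B = prodOver B (λ u → factor (ld G Va u))

-- Passing from a to a' through an edge labelled by x_v removes exactly v from Vert, so Vert_{a'} = Vert_a − {v}
-- (read-once puts v in Vert_a, uniformity keeps every other variable of Vert_a out of the paths to a').
-- Hence ld_{a'}(u) = ld_a(u) − 1 if u is a neighbour of v and ld_{a'}(u) = ld_a(u) otherwise.  Since B is
-- distant independent, at most one vertex of B is adjacent to v (and none if v ∈ B), so rw_{a'} differs
-- from rw_a in at most one factor of the product, which gives the three formulas.
module Submission where

open import Defs
open import Data.Nat using (ℕ; suc)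
open import Data.Bool using (true; false)
open import Data.Fin using (Fin; zero; suc; _≟_)
import Data.Fin.Properties as FinP
open import Data.Fin.Subset using (Subset; _∈_; _∉_; _─_; ⁅_⁆; _∩_; _∪_; _⊂_; _⊃_; ∣_∣)
open import Data.Fin.Subset.Properties
  using (p─⊥≡p; p─q⊆p; x∈p∧x≢y⇒x∈p-y; x∈⁅x⁆; x∈⁅y⁆⇒x≡y; q⊆p∪q; x∈p∪q⁺; x∈p∪q⁻; ∉⊥; _∈?_; ⊆-antisym)
open import Data.Fin.Subset.Induction using (Acc; acc; ⊃-wellFounded)
open import Data.Vec using ([]; _∷_; here; there)
open import Data.Vec.Properties using (lookup∘tabulate; []=⇒lookup; lookup⇒[]=)
open import Data.List using (List; _∷_; _++_; [_])
import Data.List.Membership.Propositional as L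
open import Data.List.Membership.Propositional.Properties using (∈-++⁺ˡ; ∈-++⁺ʳ; ∈-++⁻)
open import Data.List.Relation.Unary.Any using (here; there)
import Data.List.Relation.Unary.All as All
open import Data.List.Relation.Unary.AllPairs using (_∷_)
open import Data.List.Relation.Unary.Unique.Propositional using (Unique)
open import Data.Product using (Σ; _×_; _,_)
open import Data.Sum using (inj₁; inj₂)
open import Data.Rational using (ℚ; 1ℚ; _*_; _-_; _÷_; 1/_; NonZero)
open import Data.Rational.Properties using (*-assoc; *-comm; *-inverseʳ; *-identityʳ)
open import Function using (_∘_)
open import Function.Bundles using (Equivalence)
open import Relation.Nullary using (¬_; yes; no; contradiction)
open import Relation.Binary.PropositionalEquality
  using (_≡_; _≢_; refl; sym; trans; cong; cong₂; subst; ≢-sym; module ≡-Reasoning)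

open Equivalence using (to; from)

x∉p-x : ∀ {n} (p : Subset n) x → x ∉ p ─ ⁅ x ⁆
x∉p-x (_ ∷ p) zero    ()
x∉p-x (_ ∷ p) (suc x) (there x∈p-x) = x∉p-x p x x∈p-x

x∈p-y⇒x≢y : ∀ {n} {p : Subset n} {x y} → x ∈ p ─ ⁅ y ⁆ → x ≢ y
x∈p-y⇒x≢y {p = p} x∈p-x refl = x∉p-x p _ x∈p-x

∣p∩[q-x]∣≡∣p∩q∣ : ∀ {n} (p q : Subset n) {x} → x ∉ p → ∣ p ∩ (q ─ ⁅ x ⁆) ∣ ≡ ∣ p ∩ q ∣
∣p∩[q-x]∣≡∣p∩q∣ (false ∷ p) (_     ∷ q) {zero}  _   = cong (λ r → ∣ p ∩ r ∣) (p─⊥≡p q)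
∣p∩[q-x]∣≡∣p∩q∣ (true  ∷ p) _           {zero}  x∉p = contradiction here x∉p
∣p∩[q-x]∣≡∣p∩q∣ (true  ∷ p) (true  ∷ q) {suc x} x∉p = cong suc (∣p∩[q-x]∣≡∣p∩q∣ p q (x∉p ∘ there))
∣p∩[q-x]∣≡∣p∩q∣ (true  ∷ p) (false ∷ q) {suc x} x∉p = ∣p∩[q-x]∣≡∣p∩q∣ p q (x∉p ∘ there)
∣p∩[q-x]∣≡∣p∩q∣ (false ∷ p) (_     ∷ q) {suc x} x∉p = ∣p∩[q-x]∣≡∣p∩q∣ p q (x∉p ∘ there)

suc∣p∩[q-x]∣≡∣p∩q∣ : ∀ {n} (p q : Subset n) {x} → x ∈ p → x ∈ q → suc ∣ p ∩ (q ─ ⁅ x ⁆) ∣ ≡ ∣ p ∩ q ∣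
suc∣p∩[q-x]∣≡∣p∩q∣ (true  ∷ p) (true  ∷ q) here        here        = cong (λ r → suc ∣ p ∩ r ∣) (p─⊥≡p q)
suc∣p∩[q-x]∣≡∣p∩q∣ (true  ∷ p) (true  ∷ q) (there x∈p) (there x∈q) = cong suc (suc∣p∩[q-x]∣≡∣p∩q∣ p q x∈p x∈q)
suc∣p∩[q-x]∣≡∣p∩q∣ (true  ∷ p) (false ∷ q) (there x∈p) (there x∈q) = suc∣p∩[q-x]∣≡∣p∩q∣ p q x∈p x∈q
suc∣p∩[q-x]∣≡∣p∩q∣ (false ∷ p) (_     ∷ q) (there x∈p) (there x∈q) = suc∣p∩[q-x]∣≡∣p∩q∣ p q x∈p x∈q

prodOver-cong : ∀ {n} (B : Subset n) {f g : Fin n → ℚ} → (∀ {u} → u ∈ B → f u ≡ g u) →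
                prodOver B f ≡ prodOver B g
prodOver-cong []          _   = refl
prodOver-cong (true  ∷ B) f≗g = cong₂ _*_ (f≗g here) (prodOver-cong B (f≗g ∘ there))
prodOver-cong (false ∷ B) f≗g = prodOver-cong B (f≗g ∘ there)

prodOver-remove : ∀ {n} (B : Subset n) (f : Fin n → ℚ) {w} → w ∈ B → prodOver B f ≡ prodOver (B ─ ⁅ w ⁆) f * f w
prodOver-remove (true ∷ B) f {zero} here = begin
  f zero * prodOver B (f ∘ suc)         ≡⟨ *-comm (f zero) _ ⟩
  prodOver B (f ∘ suc) * f zero         ≡⟨ cong (λ r → prodOver r (f ∘ suc) * f zero) (p─⊥≡p B) ⟨
  prodOver (B ─ _) (f ∘ suc) * f zero   ∎
  where open ≡-Reasoning
prodOver-remove (true ∷ B) f {suc w} (there w∈B) = begin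
  f zero * prodOver B (f ∘ suc)                      ≡⟨ cong (f zero *_) (prodOver-remove B (f ∘ suc) w∈B) ⟩
  f zero * (prodOver (B ─ ⁅ w ⁆) (f ∘ suc) * f (suc w)) ≡⟨ *-assoc (f zero) _ _ ⟨
  f zero * prodOver (B ─ ⁅ w ⁆) (f ∘ suc) * f (suc w)   ∎
  where open ≡-Reasoning
prodOver-remove (false ∷ B) f {suc w} (there w∈B) = prodOver-remove B (f ∘ suc) w∈B

*-÷-cancelʳ : ∀ x c .{{_ : NonZero c}} → (x * c) ÷ c ≡ x
*-÷-cancelʳ x c = begin
  x * c * 1/ c    ≡⟨ *-assoc x c (1/ c) ⟩
  x * (c * 1/ c)  ≡⟨ cong (x *_) (*-inverseʳ c) ⟩
  x * 1ℚ          ≡⟨ *-identityʳ x ⟩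
  x               ∎
  where open ≡-Reasoning

*-rescale : ∀ x c d .{{_ : NonZero c}} → x * d ≡ (x * c) * (d ÷ c)
*-rescale x c d = begin
  x * d                  ≡⟨ cong (x *_) (*-÷-cancelʳ d c) ⟨
  x * (d * c * 1/ c)     ≡⟨ cong (λ y → x * (y * 1/ c)) (*-comm d c) ⟩
  x * (c * d * 1/ c)     ≡⟨ cong (x *_) (*-assoc c d (1/ c)) ⟩
  x * (c * (d * 1/ c))   ≡⟨ *-assoc x c _ ⟨
  x * c * (d ÷ c)        ∎
  where open ≡-Reasoning

∉-of-Unique-++-[_] : ∀ {a} {A : Set a} (xs : List A) {x} → Unique (xs ++ [ x ]) → ¬ (x L.∈ xs)
∉-of-Unique-++-[_] (_ ∷ xs) (y≢ ∷ _) (here refl)  = All.lookup y≢ (∈-++⁺ʳ xs (here refl)) refl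
∉-of-Unique-++-[_] (_ ∷ xs) (_ ∷ !xs) (there x∈xs) = ∉-of-Unique-++-[_] xs !xs x∈xs

module _ {n} {Y : LBP n} where

  snoc : ∀ {p} e → Path Y p (src Y e) → Path Y p (tgt Y e)
  snoc e []             = e ∷⟨ refl ⟩ []
  snoc e (e' ∷⟨ eq ⟩ P) = e' ∷⟨ eq ⟩ snoc e P

  vars-snoc : ∀ {p} e (P : Path Y p (src Y e)) → vars (snoc e P) ≡ vars P ++ [ var (lab Y e) ]
  vars-snoc e []            = refl
  vars-snoc e (e' ∷⟨ _ ⟩ P) = cong (var (lab Y e') ∷_) (vars-snoc e P)

  module _ (nrobp : IsNROBP Y) where
    open IsNROBP nrobp

    -- Walk backwards from a along in-edges while collecting in T nodes reachable from the current node;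
    -- acyclicity makes every predecessor new, so T grows strictly and the walk must stop at the root.
    reachable-from-root : ∀ a → Path Y (root Y) a
    reachable-from-root a = walk _ (⊃-wellFounded _) (λ q∈⊥ → contradiction q∈⊥ ∉⊥) []
      where
      walk : ∀ {p} T → Acc _⊃_ T → (∀ {q} → q ∈ T → Path Y p q) → Path Y p a → Path Y (root Y) a
      walk {p} T (acc smaller) reach p⇝a with p ≟ root Y
      ... | yes refl = p⇝a
      ... | no p≢root with FinP.any? (λ e → tgt Y e ≟ p)
      ...   | no noInEdge = contradiction (from (one-root p) (λ e tgt≡p → noInEdge (e , tgt≡p))) p≢root
      ...   | yes (e , refl) with src Y e ∈? T
      ...     | yes s∈T = contradiction (reach s∈T) (acyclic e)
      ...     | no  s∉T = walk (⁅ src Y e ⁆ ∪ T) (smaller T⊂T') reach' (e ∷⟨ refl ⟩ p⇝a)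
        where
        T⊂T' : T ⊂ ⁅ src Y e ⁆ ∪ T
        T⊂T' = q⊆p∪q ⁅ src Y e ⁆ T , src Y e , x∈p∪q⁺ (inj₁ (x∈⁅x⁆ (src Y e))) , s∉T
        reach' : ∀ {q} → q ∈ ⁅ src Y e ⁆ ∪ T → Path Y (src Y e) q
        reach' q∈T' with x∈p∪q⁻ ⁅ src Y e ⁆ T q∈T'
        ... | inj₁ q∈⁅s⁆ rewrite x∈⁅y⁆⇒x≡y _ q∈⁅s⁆ = []
        ... | inj₂ q∈T = e ∷⟨ refl ⟩ reach q∈T

    module _ (e : Edge Y) {Va : Subset n} (vert : IsVert Y (src Y e) Va) where
      private
        v = var (lab Y e)
        P₀ = reachable-from-root (src Y e)

        ∈-vars-snoc : ∀ {x} (P : Path Y (root Y) (src Y e)) → x L.∈ vars P → x L.∈ vars (snoc e P)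
        ∈-vars-snoc P x∈P = subst (_ L.∈_) (sym (vars-snoc e P)) (∈-++⁺ˡ x∈P)

        v∈vars-snoc : ∀ (P : Path Y (root Y) (src Y e)) → v L.∈ vars (snoc e P)
        v∈vars-snoc P = subst (v L.∈_) (sym (vars-snoc e P)) (∈-++⁺ʳ (vars P) (here refl))

      var∈Vert-src : v ∈ Va
      var∈Vert-src = from (vert v) λ P →
        ∉-of-Unique-++-[ vars P ] (subst Unique (vars-snoc e P) (read-once (snoc e P)))

      Vert-tgt≡Vert-src-var : Uniform Y → ∀ {Va'} → IsVert Y (tgt Y e) Va' → Va' ≡ Va ─ ⁅ v ⁆
      Vert-tgt≡Vert-src-var (same-vars , _) {Va'} vert' = ⊆-antisym ⊆-Va-v Va-v-⊆
        where
        v∉Va' : v ∉ Va'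
        v∉Va' v∈Va' = to (vert' v) v∈Va' (snoc e P₀) (v∈vars-snoc P₀)

        ⊆-Va-v : ∀ {x} → x ∈ Va' → x ∈ Va ─ ⁅ v ⁆
        ⊆-Va-v {x} x∈Va' = x∈p∧x≢y⇒x∈p-y
          (from (vert x) λ P x∈P → to (vert' x) x∈Va' (snoc e P) (∈-vars-snoc P x∈P))
          (λ { refl → v∉Va' x∈Va' })

        Va-v-⊆ : ∀ {x} → x ∈ Va ─ ⁅ v ⁆ → x ∈ Va'
        Va-v-⊆ {x} x∈Va-v = from (vert' x) λ Q x∈Q →
          case (subst (x L.∈_) (vars-snoc e P₀) (same-vars (tgt Y e) Q (snoc e P₀) x x∈Q))
          where
          case : ¬ (x L.∈ vars P₀ ++ [ v ])
          case x∈ with ∈-++⁻ (vars P₀) x∈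
          ... | inj₁ x∈P₀        = to (vert x) (p─q⊆p Va ⁅ v ⁆ x∈Va-v) P₀ x∈P₀
          ... | inj₂ (here refl) = x∈p-y⇒x≢y x∈Va-v refl

-- Instance search cannot recover k from NonZero (factor k), which unfolds past factor.
_÷-factor_ : ℚ → ℕ → ℚ
x ÷-factor k = _÷_ x (factor k) {{factor-nonZero {k}}}

module _ {n} (G : Graph n) where

  private
    ∈N⇒adj : ∀ {u v} → v ∈ N G u → adj G u v ≡ true
    ∈N⇒adj {u} {v} v∈N = trans (sym (lookup∘tabulate (adj G u) v)) ([]=⇒lookup v∈N)

    adj⇒∈N : ∀ {u v} → adj G u v ≡ true → v ∈ N G u
    adj⇒∈N {u} {v} uv = lookup⇒[]= v (N G u) (trans (lookup∘tabulate (adj G u) v) uv)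

  ld-remove-nonNeighbour : ∀ {Va v u} → adj G u v ≡ false → ld G (Va ─ ⁅ v ⁆) u ≡ ld G Va u
  ld-remove-nonNeighbour {Va} {v} {u} uv =
    ∣p∩[q-x]∣≡∣p∩q∣ (N G u) Va λ v∈N → contradiction (trans (sym uv) (∈N⇒adj v∈N)) λ ()

  ld-remove-neighbour : ∀ {Va v u} → adj G u v ≡ true → v ∈ Va → suc (ld G (Va ─ ⁅ v ⁆) u) ≡ ld G Va u
  ld-remove-neighbour {Va} {v} {u} uv v∈Va = suc∣p∩[q-x]∣≡∣p∩q∣ (N G u) Va (adj⇒∈N uv) v∈Va

  module _ {Va : Subset n} {v : Fin n} where

    rw-remove-nonNeighbours : ∀ {B} → (∀ {u} → u ∈ B → adj G u v ≡ false) → rw G (Va ─ ⁅ v ⁆) B ≡ rw G Va B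
    rw-remove-nonNeighbours {B} nonAdj =
      prodOver-cong B λ u∈B → cong factor (ld-remove-nonNeighbour {Va} {v} (nonAdj u∈B))

    rw-remove-member : ∀ {B w} → w ∈ B → (∀ {u} → u ∈ B ─ ⁅ w ⁆ → adj G u v ≡ false) →
                       rw G (Va ─ ⁅ v ⁆) (B ─ ⁅ w ⁆) ≡ rw G Va B ÷-factor ld G Va w
    rw-remove-member {B} {w} w∈B nonAdj = begin
      rw G (Va ─ ⁅ v ⁆) (B ─ ⁅ w ⁆)                     ≡⟨ rw-remove-nonNeighbours nonAdj ⟩
      rw G Va (B ─ ⁅ w ⁆)                               ≡⟨ *-÷-cancelʳ _ (factor k) {{factor-nonZero {k}}} ⟨
      (rw G Va (B ─ ⁅ w ⁆) * factor k) ÷-factor k       ≡⟨ cong (_÷-factor k) (prodOver-remove B _ w∈B) ⟨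
      rw G Va B ÷-factor k                              ∎
      where
      open ≡-Reasoning
      k = ld G Va w

    rw-keep-neighbour : ∀ {B w} → w ∈ B → adj G w v ≡ true → v ∈ Va →
                        (∀ {u} → u ∈ B ─ ⁅ w ⁆ → adj G u v ≡ false) →
                        rw G (Va ─ ⁅ v ⁆) B ≡ rw G Va B * ((1ℚ - halfPow (ld G Va w)) ÷-factor ld G Va w)
    rw-keep-neighbour {B} {w} w∈B wv v∈Va nonAdj = begin
      rw G (Va ─ ⁅ v ⁆) B                                           ≡⟨ prodOver-remove B _ w∈B ⟩
      rw G (Va ─ ⁅ v ⁆) (B ─ ⁅ w ⁆) * factor (ld G (Va ─ ⁅ v ⁆) w) ≡⟨ cong₂ _*_ (rw-remove-nonNeighbours nonAdj) factor≡ ⟩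
      rest * d                                                      ≡⟨ *-rescale rest (factor k) d {{factor-nonZero {k}}} ⟩
      rest * factor k * (d ÷-factor k)                              ≡⟨ cong (_* (d ÷-factor k)) (prodOver-remove B _ w∈B) ⟨
      rw G Va B * (d ÷-factor k)                                    ∎
      where
      open ≡-Reasoning
      k = ld G Va w
      d = 1ℚ - halfPow k
      rest = rw G Va (B ─ ⁅ w ⁆)
      -- factor j is 1 − 2^{-(j+1)}, and w loses the neighbour v from Vert.
      factor≡ : factor (ld G (Va ─ ⁅ v ⁆) w) ≡ d
      factor≡ = cong (λ j → 1ℚ - halfPow j) (ld-remove-neighbour {Va} wv v∈Va)

lemma8 : ∀ {n : ℕ} (G : Graph n) → NoIsolated G →
         (Y : LBP n) → IsNFBDD Y → Uniform Y → Realizes Y (Satφ G) →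
         (a a' : Node Y) (v : Fin n) → VarIs Y a v → OutNeighbour Y a a' →
         (B : Subset n) → DistantIndep G B →
         (Va Va' : Subset n) → IsVert Y a Va → IsVert Y a' Va' →
         ((v ∈ B → rw G Va' (B ─ ⁅ v ⁆) ≡ _÷_ (rw G Va B) (factor (ld G Va v)) {{factor-nonZero {ld G Va v}}}) ×
          (∀ (w : Fin n) → w ∈ B → adj G v w ≡ true →
             (rw G Va' (B ─ ⁅ w ⁆) ≡ _÷_ (rw G Va B) (factor (ld G Va w)) {{factor-nonZero {ld G Va w}}}) ×
             (rw G Va' B ≡ rw G Va B * _÷_ (1ℚ - halfPow (ld G Va w)) (factor (ld G Va w)) {{factor-nonZero {ld G Va w}}})) ×
          (v ∉ B → ¬ (Σ (Fin n) λ w → w ∈ B × adj G v w ≡ true) → rw G Va' B ≡ rw G Va B))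
lemma8 G _ Y nfbdd uniform _ _ _ v (_ , outVar) (e , refl , refl) B (indep , distant) Va Va' vert vert'
  with refl ← outVar e refl
  with refl ← Vert-tgt≡Vert-src-var (IsNFBDD.nrobp nfbdd) e vert uniform vert'
  = (λ v∈B → rw-remove-member G v∈B λ u∈B-v → indep _ v (p─q⊆p B _ u∈B-v) v∈B)
  , (λ w w∈B vw → let wv = trans (adj-sym G w v) vw in
       rw-remove-member G w∈B (avoid w∈B wv) ,
       rw-keep-neighbour G w∈B wv (var∈Vert-src (IsNFBDD.nrobp nfbdd) e vert) (avoid w∈B wv))
  , λ _ noNeighbour → rw-remove-nonNeighbours G λ {u} u∈B →
       trans (adj-sym G u v) (≢true⇒≡false λ vu → noNeighbour (u , u∈B , vu))
  where
  avoid : ∀ {w} → w ∈ B → adj G w v ≡ true → ∀ {u} → u ∈ B ─ ⁅ w ⁆ → adj G u v ≡ false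
  avoid {w} w∈B wv u∈B-w = distant w _ v w∈B (p─q⊆p B _ u∈B-w) (≢-sym (x∈p-y⇒x≢y u∈B-w)) wv

  ≢true⇒≡false : ∀ {b} → b ≢ true → b ≡ false
  ≢true⇒≡false {false} _      = refl
  ≢true⇒≡false {true}  b≢true = contradiction refl b≢true
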